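{- For all integers $n,m,k\ge 0$, the number of Dyck paths of semilength $n$ with $m$ contacts and $k$ up-steps at odd height equals the number of Dyck paths of semilength $n$ with $m$ contacts and $k$ peaks.
   Context: Paths are lattice paths starting at $(0,0)$ with up-steps $(1,1)$ and down-steps $(1,-1)$. A Dyck path of semilength $n$ has $n$ up-steps and $n$ down-steps, ends on $y=0$, and has no vertex with negative $y$-coordinate. An up-step from $(i-1,j-1)$ to $(i,j)$ is at height $j$; a down-step from $(i,j)$ to $(i+1,j-1)$ is at height $j$; a step is at odd height if $j$ is odd. A peak is an up-step immediately followed by a down-step. A contact is a down-step at height $1$ or an up-step at height $0$. -}

module Defs where

open import Data.Nat using (ℕ; zero; suc; _+_; _*_; _≡ᵇ_)
open import Data.Bool using (Bool; true; false; _∧_; if_then_else_)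
open import Data.List using (List; []; _∷_; map; _++_; length; filter)
open import Data.Unit using (⊤)
open import Data.Empty using (⊥)
open import Relation.Nullary.Decidable using (Dec; yes; no; _×-dec_)
open import Data.Product using (_×_)
open import Relation.Binary.PropositionalEquality using (_≡_)
open import Data.Nat.Properties using (_≟_)

data Step : Set where
  U D : Step

Path : Set
Path = List Step

allPaths : ℕ → List Path
allPaths zero = [] ∷ []
allPaths (suc ℓ) = map (U ∷_) (allPaths ℓ) ++ map (D ∷_) (allPaths ℓ)

staysNonnegEndsZero : ℕ → Path → Bool
staysNonnegEndsZero zero    []      = true
staysNonnegEndsZero (suc h) []      = false
staysNonnegEndsZero h       (U ∷ p) = staysNonnegEndsZero (suc h) p
staysNonnegEndsZero zero    (D ∷ p) = false
staysNonnegEndsZero (suc h) (D ∷ p) = staysNonnegEndsZero h p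

ups : Path → ℕ
ups []      = 0
ups (U ∷ p) = suc (ups p)
ups (D ∷ p) = ups p

downs : Path → ℕ
downs []      = 0
downs (U ∷ p) = downs p
downs (D ∷ p) = suc (downs p)

IsDyck : ℕ → Path → Set
IsDyck n p = (ups p ≡ n) × (downs p ≡ n) × (staysNonnegEndsZero 0 p ≡ true)

isDyck? : ∀ n p → Dec (IsDyck n p)
isDyck? n p = (ups p ≟ n) ×-dec ((downs p ≟ n) ×-dec (staysNonnegEndsZero 0 p Data.Bool.≟ true))
  where import Data.Bool

dyckPaths : ℕ → List Path
dyckPaths n = filter (isDyck? n) (allPaths (n + n))

isOdd : ℕ → Bool
isOdd zero = false
isOdd (suc zero) = true
isOdd (suc (suc j)) = isOdd j

b2n : Bool → ℕ
b2n true = 1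
b2n false = 0

-- Statistics, with the current starting height h as a parameter.
-- An up-step from height h to h+1 is "at height h+1";
-- a down-step from height h+1 to h is "at height h+1".

contactsFrom : ℕ → Path → ℕ
contactsFrom h [] = 0
contactsFrom h (U ∷ p) = contactsFrom (suc h) p
contactsFrom zero (D ∷ p) = contactsFrom zero p
contactsFrom (suc h) (D ∷ p) = b2n (h ≡ᵇ 0) + contactsFrom h p

contacts : Path → ℕ
contacts = contactsFrom 0

oddUpsFrom : ℕ → Path → ℕ
oddUpsFrom h [] = 0
oddUpsFrom h (U ∷ p) = b2n (isOdd (suc h)) + oddUpsFrom (suc h) p
oddUpsFrom zero (D ∷ p) = oddUpsFrom zero p
oddUpsFrom (suc h) (D ∷ p) = oddUpsFrom h p

oddUps : Path → ℕ
oddUps = oddUpsFrom 0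

peaks : Path → ℕ
peaks [] = 0
peaks (U ∷ D ∷ p) = suc (peaks (D ∷ p))
peaks (U ∷ p) = peaks p
peaks (D ∷ p) = peaks p

countOddUps : ℕ → ℕ → ℕ → ℕ
countOddUps n m k =
  length (filter (λ p → (contacts p ≟ m) ×-dec (oddUps p ≟ k)) (dyckPaths n))

countPeaks : ℕ → ℕ → ℕ → ℕ
countPeaks n m k =
  length (filter (λ p → (contacts p ≟ m) ×-dec (peaks p ≟ k)) (dyckPaths n))

-- Reading U p D q as the binary tree with left subtree p and right subtree q identifies Dyck
-- paths of semilength n with binary trees with n nodes. Contacts become the nodes of the right
-- spine, peaks the leaves that are left children, and up-steps at odd height the nodes reached
-- from the root through an even number of left edges. Recursively mirroring every left subtree
-- is a bijection of trees that keeps the size and the right spine, and it carries the nodes at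
-- even left-depth to the left leaves; since mirroring swaps left and right leaves, this is
-- proved jointly with the statement matching nodes at odd left-depth with right leaves.
module Submission where

open import Defs
open import Data.Bool using (Bool; true; false; not)
open import Data.List using (List; []; _∷_; _++_; length; map; filter)
open import Data.List.Properties using (map-∘; map-id-local; filter-accept; filter-reject)
open import Data.List.Membership.Propositional using (_∈_)
open import Data.List.Membership.Propositional.Properties
  using (∈-map⁺; ∈-map⁻; ∈-++⁺ˡ; ∈-++⁺ʳ; ∈-filter⁺; ∈-filter⁻)
open import Data.List.Membership.Propositional.Properties.WithK using (unique∧set⇒bag)
open import Data.List.Relation.Binary.BagAndSetEquality using (∼bag⇒↭)
open import Data.List.Relation.Binary.Permutation.Propositional using (_↭_)
open import Data.List.Relation.Binary.Permutation.Propositional.Properties using (↭-length; filter-↭)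
open import Data.List.Relation.Unary.All as All using (All; []; _∷_)
open import Data.List.Relation.Unary.AllPairs using ([]; _∷_)
open import Data.List.Relation.Unary.Any using (here)
open import Data.List.Relation.Unary.Unique.Propositional using (Unique)
import Data.List.Relation.Unary.Unique.Propositional.Properties as Unique
open import Data.Nat using (ℕ; zero; suc; _+_; _≤_; z≤n; s≤s; _≟_)
open import Data.Nat.Properties
  using (≤-refl; ≤-trans; m≤m+n; m≤n+m; n≤1+n; +-identityʳ; +-assoc; +-comm; +-suc)
open import Data.Product using (_×_; _,_; proj₁; proj₂; map₁)
open import Function using (_∘_)
open import Function.Bundles using (_⇔_; mk⇔; Equivalence)
open import Relation.Binary.PropositionalEquality
open import Relation.Nullary using (¬_; yes; no)
open import Relation.Nullary.Decidable using (_×-dec_)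
open import Relation.Unary using (Pred; Decidable)
open import Level using (0ℓ)

filter-≐-local : ∀ {A : Set} {P Q : Pred A 0ℓ} (P? : Decidable P) (Q? : Decidable Q) {xs} →
                 All (λ x → P x ⇔ Q x) xs → filter P? xs ≡ filter Q? xs
filter-≐-local P? Q? [] = refl
filter-≐-local P? Q? {x ∷ _} (Px⇔Qx ∷ xs⇔) with P? x
... | yes Px = trans (cong (x ∷_) (filter-≐-local P? Q? xs⇔))
                     (sym (filter-accept Q? (Equivalence.to Px⇔Qx Px)))
... | no ¬Px = trans (filter-≐-local P? Q? xs⇔)
                     (sym (filter-reject Q? (¬Px ∘ Equivalence.from Px⇔Qx)))

length-filter-map : ∀ {A : Set} {P : Pred A 0ℓ} (P? : Decidable P) (f : A → A) xs →
                    length (filter P? (map f xs)) ≡ length (filter (P? ∘ f) xs)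
length-filter-map P? f [] = refl
length-filter-map P? f (x ∷ xs) with P? (f x)
... | yes _ = cong suc (length-filter-map P? f xs)
... | no _  = length-filter-map P? f xs

map-↭ : ∀ {A : Set} {xs : List A} {f g : A → A} → Unique xs →
        (∀ {x} → x ∈ xs → f x ∈ xs) → (∀ {x} → x ∈ xs → g x ∈ xs) →
        (∀ {x} → x ∈ xs → g (f x) ≡ x) → (∀ {x} → x ∈ xs → f (g x) ≡ x) →
        map f xs ↭ xs
map-↭ {xs = xs} {f} {g} xs! f∈ g∈ g∘f≗id f∘g≗id =
  ∼bag⇒↭ (unique∧set⇒bag fxs! xs! (mk⇔ to from))
  where
  g∘f-xs : map g (map f xs) ≡ xs
  g∘f-xs = trans (sym (map-∘ xs)) (map-id-local (All.tabulate g∘f≗id))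
  fxs! : Unique (map f xs)
  fxs! = Unique.map⁻ {f = g} (subst Unique (sym g∘f-xs) xs!)
  to : ∀ {y} → y ∈ map f xs → y ∈ xs
  to y∈ with _ , x∈ , refl ← ∈-map⁻ f y∈ = f∈ x∈
  from : ∀ {y} → y ∈ xs → y ∈ map f xs
  from y∈ = subst (_∈ map f xs) (f∘g≗id y∈) (∈-map⁺ f (g∈ y∈))

data Tree : Set where
  leaf : Tree
  node : Tree → Tree → Tree

size : Tree → ℕ
size leaf       = 0
size (node l r) = suc (size l + size r)

encode : Tree → Path → Path
encode leaf       x = x
encode (node l r) x = U ∷ encode l (D ∷ encode r x)

toPath : Tree → Path
toPath t = encode t []

-- For p starting at height h + 1: the parts of p before and after its first down-step to height 0.
splitAtReturn : ℕ → Path → Path × Path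
splitAtReturn h       []      = [] , []
splitAtReturn h       (U ∷ p) = map₁ (U ∷_) (splitAtReturn (suc h) p)
splitAtReturn zero    (D ∷ p) = [] , p
splitAtReturn (suc h) (D ∷ p) = map₁ (D ∷_) (splitAtReturn h p)

-- The first argument is fuel; length p suffices.
decode : ℕ → Path → Tree
decode zero    p       = leaf
decode (suc f) []      = leaf
decode (suc f) (D ∷ p) = leaf
decode (suc f) (U ∷ p) = let (a , b) = splitAtReturn 0 p in node (decode f a) (decode f b)

fromPath : Path → Tree
fromPath p = decode (length p) p

splitAtReturn-encode : ∀ h t x → splitAtReturn h (encode t x) ≡ map₁ (encode t) (splitAtReturn h x)
splitAtReturn-encode h leaf       x = refl
splitAtReturn-encode h (node l r) x
  rewrite splitAtReturn-encode (suc h) l (D ∷ encode r x) | splitAtReturn-encode h r x = refl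

splitAtReturn-dyck : ∀ h p → staysNonnegEndsZero (suc h) p ≡ true →
                     let (a , b) = splitAtReturn h p in
                     p ≡ a ++ D ∷ b × staysNonnegEndsZero h a ≡ true × staysNonnegEndsZero 0 b ≡ true
splitAtReturn-dyck h       []      ()
splitAtReturn-dyck zero    (U ∷ p) s with p≡ , sa , sb ← splitAtReturn-dyck 1 p s =
  cong (U ∷_) p≡ , sa , sb
splitAtReturn-dyck (suc h) (U ∷ p) s
  with p≡ , sa , sb ← splitAtReturn-dyck (suc (suc h)) p s =
  cong (U ∷_) p≡ , sa , sb
splitAtReturn-dyck zero    (D ∷ p) s = refl , refl , s
splitAtReturn-dyck (suc h) (D ∷ p) s with p≡ , sa , sb ← splitAtReturn-dyck h p s =
  cong (D ∷_) p≡ , sa , sb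

length-splitAtReturn : ∀ h p → let (a , b) = splitAtReturn h p in
                       length a ≤ length p × length b ≤ length p
length-splitAtReturn h       []      = ≤-refl , ≤-refl
length-splitAtReturn h       (U ∷ p) with la , lb ← length-splitAtReturn (suc h) p =
  s≤s la , ≤-trans lb (n≤1+n _)
length-splitAtReturn zero    (D ∷ p) = z≤n , n≤1+n _
length-splitAtReturn (suc h) (D ∷ p) with la , lb ← length-splitAtReturn h p =
  s≤s la , ≤-trans lb (n≤1+n _)

encode-++ : ∀ t x y → encode t x ++ y ≡ encode t (x ++ y)
encode-++ leaf       x y = refl
encode-++ (node l r) x y =
  cong (U ∷_) (trans (encode-++ l _ y) (cong (encode l ∘ (D ∷_)) (encode-++ r x y)))

decode-toPath : ∀ f t → size t ≤ f → decode f (toPath t) ≡ t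
decode-toPath zero    leaf       _ = refl
decode-toPath (suc f) leaf       _ = refl
decode-toPath (suc f) (node l r) (s≤s size≤f)
  rewrite splitAtReturn-encode 0 l (D ∷ toPath r) =
  cong₂ node (decode-toPath f l (≤-trans (m≤m+n (size l) (size r)) size≤f))
             (decode-toPath f r (≤-trans (m≤n+m (size r) (size l)) size≤f))

toPath-decode : ∀ f p → staysNonnegEndsZero 0 p ≡ true → length p ≤ f → toPath (decode f p) ≡ p
toPath-decode zero    []      _ _ = refl
toPath-decode (suc f) []      _ _ = refl
toPath-decode (suc f) (U ∷ p) s (s≤s length≤f)
  with p≡ , sa , sb ← splitAtReturn-dyck 0 p s | la , lb ← length-splitAtReturn 0 p =
  cong (U ∷_) (begin
    encode (decode f a) (D ∷ toPath (decode f b))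
      ≡⟨ cong (encode (decode f a) ∘ (D ∷_)) (toPath-decode f b sb (≤-trans lb length≤f)) ⟩
    encode (decode f a) (D ∷ b)
      ≡⟨ sym (encode-++ (decode f a) [] (D ∷ b)) ⟩
    toPath (decode f a) ++ D ∷ b
      ≡⟨ cong (_++ D ∷ b) (toPath-decode f a sa (≤-trans la length≤f)) ⟩
    a ++ D ∷ b
      ≡⟨ sym p≡ ⟩
    p ∎)
  where
  open ≡-Reasoning
  a = proj₁ (splitAtReturn 0 p)
  b = proj₂ (splitAtReturn 0 p)

ups-encode : ∀ t x → ups (encode t x) ≡ size t + ups x
ups-encode leaf       x = refl
ups-encode (node l r) x rewrite ups-encode l (D ∷ encode r x) | ups-encode r x =
  cong suc (sym (+-assoc (size l) (size r) (ups x)))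

downs-encode : ∀ t x → downs (encode t x) ≡ size t + downs x
downs-encode leaf       x = refl
downs-encode (node l r) x rewrite downs-encode l (D ∷ encode r x) | downs-encode r x =
  trans (+-suc (size l) _) (cong suc (sym (+-assoc (size l) (size r) (downs x))))

staysNonnegEndsZero-encode : ∀ h t x → staysNonnegEndsZero h (encode t x) ≡ staysNonnegEndsZero h x
staysNonnegEndsZero-encode h       leaf       x = refl
staysNonnegEndsZero-encode zero    (node l r) x
  rewrite staysNonnegEndsZero-encode 1 l (D ∷ encode r x) = staysNonnegEndsZero-encode 0 r x
staysNonnegEndsZero-encode (suc h) (node l r) x
  rewrite staysNonnegEndsZero-encode (suc (suc h)) l (D ∷ encode r x) =
  staysNonnegEndsZero-encode (suc h) r x

toPath-isDyck : ∀ t → IsDyck (size t) (toPath t)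
toPath-isDyck t = trans (ups-encode t []) (+-identityʳ _) ,
                  trans (downs-encode t []) (+-identityʳ _) ,
                  staysNonnegEndsZero-encode 0 t []

length-ups+downs : ∀ p → length p ≡ ups p + downs p
length-ups+downs []      = refl
length-ups+downs (U ∷ p) = cong suc (length-ups+downs p)
length-ups+downs (D ∷ p) = trans (cong suc (length-ups+downs p)) (sym (+-suc (ups p) (downs p)))

fromPath-toPath : ∀ t → fromPath (toPath t) ≡ t
fromPath-toPath t = decode-toPath (length (toPath t)) t size≤length
  where
  size≤length : size t ≤ length (toPath t)
  size≤length rewrite length-ups+downs (toPath t) | ups-encode t [] =
    ≤-trans (m≤m+n (size t) 0) (m≤m+n _ _)

toPath-fromPath : ∀ {n} p → IsDyck n p → toPath (fromPath p) ≡ p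
toPath-fromPath p (_ , _ , s) = toPath-decode (length p) p s ≤-refl

size-fromPath : ∀ {n} p → IsDyck n p → size (fromPath p) ≡ n
size-fromPath {n} p d@(ups≡n , _) = begin
  size (fromPath p)         ≡⟨ sym (proj₁ (toPath-isDyck (fromPath p))) ⟩
  ups (toPath (fromPath p)) ≡⟨ cong ups (toPath-fromPath p d) ⟩
  ups p                     ≡⟨ ups≡n ⟩
  n ∎
  where open ≡-Reasoning

rightSpine : Tree → ℕ
rightSpine leaf       = 0
rightSpine (node l r) = suc (rightSpine r)

-- oddNodes b t counts the nodes at odd height, the root being at odd height iff b;
-- a left edge goes one level up, a right edge stays on the same level.
oddNodes : Bool → Tree → ℕ
oddNodes b leaf       = 0
oddNodes b (node l r) = b2n b + oddNodes (not b) l + oddNodes b r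

isLeaf : Tree → ℕ
isLeaf leaf       = 1
isLeaf (node _ _) = 0

leftLeaves : Tree → ℕ
leftLeaves leaf       = 0
leftLeaves (node l r) = isLeaf l + leftLeaves l + leftLeaves r

contacts-toPath : ∀ t → contacts (toPath t) ≡ rightSpine t
contacts-toPath t = trans (contacts-encode t []) (+-identityʳ _)
  where
  contactsFrom-suc-encode : ∀ h t x → contactsFrom (suc h) (encode t x) ≡ contactsFrom (suc h) x
  contactsFrom-suc-encode h leaf       x = refl
  contactsFrom-suc-encode h (node l r) x
    rewrite contactsFrom-suc-encode (suc h) l (D ∷ encode r x) = contactsFrom-suc-encode h r x

  contacts-encode : ∀ t x → contacts (encode t x) ≡ rightSpine t + contacts x
  contacts-encode leaf       x = refl
  contacts-encode (node l r) x
    rewrite contactsFrom-suc-encode 0 l (D ∷ encode r x) = cong suc (contacts-encode r x)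

oddUps-toPath : ∀ t → oddUps (toPath t) ≡ oddNodes true t
oddUps-toPath t = trans (oddUpsFrom-encode 0 t []) (+-identityʳ _)
  where
  not-isOdd-suc : ∀ h → not (isOdd (suc h)) ≡ isOdd h
  not-isOdd-suc zero          = refl
  not-isOdd-suc (suc zero)    = refl
  not-isOdd-suc (suc (suc h)) = not-isOdd-suc h

  oddUpsFrom-encode : ∀ h t x → oddUpsFrom h (encode t x) ≡ oddNodes (isOdd (suc h)) t + oddUpsFrom h x
  oddUpsFrom-encode h leaf       x = refl
  oddUpsFrom-encode h (node l r) x
    rewrite oddUpsFrom-encode (suc h) l (D ∷ encode r x) | oddUpsFrom-encode h r x
          | not-isOdd-suc h =
    sym (trans (+-assoc (b2n (isOdd (suc h)) + oddNodes (isOdd h) l) _ _)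
               (+-assoc (b2n (isOdd (suc h))) (oddNodes (isOdd h) l) _))

peaks-toPath : ∀ t → peaks (toPath t) ≡ leftLeaves t
peaks-toPath t = trans (peaks-encode t []) (+-identityʳ _)
  where
  peaks-encode : ∀ t x → peaks (encode t x) ≡ leftLeaves t + peaks x
  peaks-encode leaf                  x = refl
  peaks-encode (node leaf r)         x = cong suc (peaks-encode r x)
  peaks-encode (node l@(node _ _) r) x
    rewrite peaks-encode l (D ∷ encode r x) | peaks-encode r x =
    sym (+-assoc (leftLeaves l) (leftLeaves r) (peaks x))

mirror : Tree → Tree
mirror leaf       = leaf
mirror (node l r) = node (mirror r) (mirror l)

mirror-involutive : ∀ t → mirror (mirror t) ≡ t
mirror-involutive leaf       = refl
mirror-involutive (node l r) = cong₂ node (mirror-involutive l) (mirror-involutive r)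

size-mirror : ∀ t → size (mirror t) ≡ size t
size-mirror leaf       = refl
size-mirror (node l r) rewrite size-mirror l | size-mirror r = cong suc (+-comm (size r) (size l))

mirrorLefts : Tree → Tree
mirrorLefts leaf       = leaf
mirrorLefts (node l r) = node (mirror (mirrorLefts l)) (mirrorLefts r)

size-mirrorLefts : ∀ t → size (mirrorLefts t) ≡ size t
size-mirrorLefts leaf       = refl
size-mirrorLefts (node l r)
  rewrite size-mirror (mirrorLefts l) | size-mirrorLefts l | size-mirrorLefts r = refl

rightSpine-mirrorLefts : ∀ t → rightSpine (mirrorLefts t) ≡ rightSpine t
rightSpine-mirrorLefts leaf       = refl
rightSpine-mirrorLefts (node l r) = cong suc (rightSpine-mirrorLefts r)

isLeaf-mirror-mirrorLefts : ∀ t → isLeaf (mirror (mirrorLefts t)) ≡ isLeaf t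
isLeaf-mirror-mirrorLefts leaf       = refl
isLeaf-mirror-mirrorLefts (node _ _) = refl

leftLeaves-mirrorLefts : ∀ t → leftLeaves (mirrorLefts t) ≡ oddNodes true t
leftLeaves-mirror-mirrorLefts : ∀ t →
                                isLeaf t + leftLeaves (mirror (mirrorLefts t)) ≡ suc (oddNodes false t)

leftLeaves-mirrorLefts leaf       = refl
leftLeaves-mirrorLefts (node l r)
  rewrite isLeaf-mirror-mirrorLefts l | leftLeaves-mirror-mirrorLefts l | leftLeaves-mirrorLefts r =
  refl

leftLeaves-mirror-mirrorLefts leaf       = refl
leftLeaves-mirror-mirrorLefts (node l r)
  rewrite mirror-involutive (mirrorLefts l) | isLeaf-mirror-mirrorLefts r
        | leftLeaves-mirrorLefts l | leftLeaves-mirror-mirrorLefts r =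
  cong suc (+-comm (oddNodes false r) (oddNodes true l))

-- unmirrorLeftsᴹ t is unmirrorLefts (mirror t); defining both together keeps the recursion
-- structural.
unmirrorLefts unmirrorLeftsᴹ : Tree → Tree
unmirrorLefts leaf        = leaf
unmirrorLefts (node l r)  = node (unmirrorLeftsᴹ l) (unmirrorLefts r)
unmirrorLeftsᴹ leaf       = leaf
unmirrorLeftsᴹ (node l r) = node (unmirrorLefts r) (unmirrorLeftsᴹ l)

mirrorLefts-unmirrorLefts  : ∀ t → mirrorLefts (unmirrorLefts t) ≡ t
mirrorLefts-unmirrorLeftsᴹ : ∀ t → mirrorLefts (unmirrorLeftsᴹ t) ≡ mirror t
mirrorLefts-unmirrorLefts leaf        = refl
mirrorLefts-unmirrorLefts (node l r)  =
  cong₂ node (trans (cong mirror (mirrorLefts-unmirrorLeftsᴹ l)) (mirror-involutive l))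
             (mirrorLefts-unmirrorLefts r)
mirrorLefts-unmirrorLeftsᴹ leaf       = refl
mirrorLefts-unmirrorLeftsᴹ (node l r) =
  cong₂ node (cong mirror (mirrorLefts-unmirrorLefts r)) (mirrorLefts-unmirrorLeftsᴹ l)

unmirrorLefts-mirrorLefts  : ∀ t → unmirrorLefts (mirrorLefts t) ≡ t
unmirrorLeftsᴹ-mirrorLefts : ∀ t → unmirrorLeftsᴹ (mirror (mirrorLefts t)) ≡ t
unmirrorLefts-mirrorLefts leaf        = refl
unmirrorLefts-mirrorLefts (node l r)  =
  cong₂ node (unmirrorLeftsᴹ-mirrorLefts l) (unmirrorLefts-mirrorLefts r)
unmirrorLeftsᴹ-mirrorLefts leaf       = refl
unmirrorLeftsᴹ-mirrorLefts (node l r) rewrite mirror-involutive (mirrorLefts l) =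
  cong₂ node (unmirrorLefts-mirrorLefts l) (unmirrorLeftsᴹ-mirrorLefts r)

size-unmirrorLefts : ∀ t → size (unmirrorLefts t) ≡ size t
size-unmirrorLefts t =
  trans (sym (size-mirrorLefts (unmirrorLefts t))) (cong size (mirrorLefts-unmirrorLefts t))

viaTrees : (Tree → Tree) → Path → Path
viaTrees h p = toPath (h (fromPath p))

viaTrees-isDyck : ∀ {h n} → (∀ t → size (h t) ≡ size t) →
                  ∀ p → IsDyck n p → IsDyck n (viaTrees h p)
viaTrees-isDyck {h} size-h p d =
  subst (λ s → IsDyck s (viaTrees h p)) (trans (size-h _) (size-fromPath p d)) (toPath-isDyck _)

viaTrees-inverse : ∀ {n} (g h : Tree → Tree) → (∀ t → g (h t) ≡ t) →
                   ∀ p → IsDyck n p → viaTrees g (viaTrees h p) ≡ p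
viaTrees-inverse g h g∘h≗id p d = begin
  toPath (g (fromPath (toPath (h (fromPath p))))) ≡⟨ cong (toPath ∘ g) (fromPath-toPath _) ⟩
  toPath (g (h (fromPath p)))                     ≡⟨ cong toPath (g∘h≗id _) ⟩
  toPath (fromPath p)                             ≡⟨ toPath-fromPath p d ⟩
  p                                               ∎
  where open ≡-Reasoning

unique-allPaths : ∀ ℓ → Unique (allPaths ℓ)
unique-allPaths zero    = [] ∷ []
unique-allPaths (suc ℓ) =
  Unique.++⁺ (Unique.map⁺ ∷-injective (unique-allPaths ℓ))
             (Unique.map⁺ ∷-injective (unique-allPaths ℓ))
             U≢D
  where
  ∷-injective : ∀ {s : Step} {p q : Path} → s ∷ p ≡ s ∷ q → p ≡ q
  ∷-injective refl = refl
  U≢D : ∀ {p} → ¬ (p ∈ map (U ∷_) (allPaths ℓ) × p ∈ map (D ∷_) (allPaths ℓ))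
  U≢D (p∈U , p∈D)
    with _ , _ , refl ← ∈-map⁻ (U ∷_) p∈U
    with _ , _ , ()   ← ∈-map⁻ (D ∷_) p∈D

∈-allPaths : ∀ p → p ∈ allPaths (length p)
∈-allPaths []      = here refl
∈-allPaths (U ∷ p) = ∈-++⁺ˡ (∈-map⁺ (U ∷_) (∈-allPaths p))
∈-allPaths (D ∷ p) =
  ∈-++⁺ʳ (map (U ∷_) (allPaths (length p))) (∈-map⁺ (D ∷_) (∈-allPaths p))

∈-dyckPaths⁻ : ∀ {n p} → p ∈ dyckPaths n → IsDyck n p
∈-dyckPaths⁻ {n} p∈ = proj₂ (∈-filter⁻ (isDyck? n) {xs = allPaths (n + n)} p∈)

∈-dyckPaths⁺ : ∀ {n p} → IsDyck n p → p ∈ dyckPaths n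
∈-dyckPaths⁺ {n} {p} d@(ups≡n , downs≡n , _) =
  ∈-filter⁺ (isDyck? n) (subst (λ ℓ → p ∈ allPaths ℓ) length≡n+n (∈-allPaths p)) d
  where
  length≡n+n : length p ≡ n + n
  length≡n+n = trans (length-ups+downs p) (cong₂ _+_ ups≡n downs≡n)

unique-dyckPaths : ∀ n → Unique (dyckPaths n)
unique-dyckPaths n = Unique.filter⁺ (isDyck? n) (unique-allPaths (n + n))

φ ψ : Path → Path
φ = viaTrees mirrorLefts
ψ = viaTrees unmirrorLefts

map-φ-↭ : ∀ n → map φ (dyckPaths n) ↭ dyckPaths n
map-φ-↭ n = map-↭ {f = φ} {g = ψ} (unique-dyckPaths n)
  (λ {p} p∈ → ∈-dyckPaths⁺ (viaTrees-isDyck size-mirrorLefts p (dyck p∈)))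
  (λ {p} p∈ → ∈-dyckPaths⁺ (viaTrees-isDyck size-unmirrorLefts p (dyck p∈)))
  (λ {p} p∈ → viaTrees-inverse unmirrorLefts mirrorLefts unmirrorLefts-mirrorLefts p (dyck p∈))
  (λ {p} p∈ → viaTrees-inverse mirrorLefts unmirrorLefts mirrorLefts-unmirrorLefts p (dyck p∈))
  where
  dyck : ∀ {p} → p ∈ dyckPaths n → IsDyck n p
  dyck = ∈-dyckPaths⁻

contacts-φ : ∀ {n} p → IsDyck n p → contacts (φ p) ≡ contacts p
contacts-φ p d = begin
  contacts (toPath (mirrorLefts (fromPath p))) ≡⟨ contacts-toPath (mirrorLefts (fromPath p)) ⟩
  rightSpine (mirrorLefts (fromPath p))        ≡⟨ rightSpine-mirrorLefts (fromPath p) ⟩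
  rightSpine (fromPath p)                      ≡⟨ sym (contacts-toPath (fromPath p)) ⟩
  contacts (toPath (fromPath p))               ≡⟨ cong contacts (toPath-fromPath p d) ⟩
  contacts p                                   ∎
  where open ≡-Reasoning

peaks-φ : ∀ {n} p → IsDyck n p → peaks (φ p) ≡ oddUps p
peaks-φ p d = begin
  peaks (toPath (mirrorLefts (fromPath p))) ≡⟨ peaks-toPath (mirrorLefts (fromPath p)) ⟩
  leftLeaves (mirrorLefts (fromPath p))     ≡⟨ leftLeaves-mirrorLefts (fromPath p) ⟩
  oddNodes true (fromPath p)                ≡⟨ sym (oddUps-toPath (fromPath p)) ⟩
  oddUps (toPath (fromPath p))              ≡⟨ cong oddUps (toPath-fromPath p d) ⟩
  oddUps p                                  ∎
  where open ≡-Reasoning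

corollary1 : (n m k : ℕ) → countOddUps n m k ≡ countPeaks n m k
corollary1 n m k = begin
  length (filter P? (dyckPaths n))
    ≡⟨ cong length (filter-≐-local P? (Q? ∘ φ) (All.tabulate P⇔Q∘φ)) ⟩
  length (filter (Q? ∘ φ) (dyckPaths n))
    ≡⟨ sym (length-filter-map Q? φ (dyckPaths n)) ⟩
  length (filter Q? (map φ (dyckPaths n)))
    ≡⟨ ↭-length (filter-↭ Q? (map-φ-↭ n)) ⟩
  length (filter Q? (dyckPaths n)) ∎
  where
  open ≡-Reasoning
  P? = λ p → (contacts p ≟ m) ×-dec (oddUps p ≟ k)
  Q? = λ p → (contacts p ≟ m) ×-dec (peaks p ≟ k)
  P⇔Q∘φ : ∀ {p} → p ∈ dyckPaths n →
          (contacts p ≡ m × oddUps p ≡ k) ⇔ (contacts (φ p) ≡ m × peaks (φ p) ≡ k)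
  P⇔Q∘φ {p} p∈ = mk⇔ (λ (c , o) → trans contacts≡ c , trans peaks≡ o)
                     (λ (c , o) → trans (sym contacts≡) c , trans (sym peaks≡) o)
    where
    contacts≡ = contacts-φ p (∈-dyckPaths⁻ {n} p∈)
    peaks≡    = peaks-φ p (∈-dyckPaths⁻ {n} p∈)
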